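{- Let $k\ge 1$ be an integer and let $G$ be a finite simple graph of order $n$. Then $$\gamma_{kR}(G)\cdot d_{R}^k(G)\le 2kn.$$ Moreover, if $\gamma_{kR}(G)\cdot d_{R}^k(G)=2kn$, then for each Roman $(k,k)$-dominating family $\{f_1,\ldots,f_d\}$ on $G$ with $d=d_R^k(G)$, each function $f_i$ is a Roman $k$-dominating function of weight $\gamma_{kR}(G)$, and $\sum_{i=1}^d f_i(v)=2k$ for all $v\in V(G)$.
   Context: Let $k\ge1$ be an integer. A Roman $k$-dominating function (RkDF) on a graph $G$ is a map $f:V(G)\to\{0,1,2\}$ such that every vertex $v$ with $f(v)=0$ has at least $k$ neighbors $u$ with $f(u)=2$. Its weight is $\sum_{v\in V(G)}f(v)$. The Roman $k$-domination number $\gamma_{kR}(G)$ is the minimum weight of an RkDF on $G$. A set $\{f_1,\ldots,f_d\}$ of pairwise distinct RkDFs on $G$ with $\sum_{i=1}^d f_i(v)\le 2k$ for every $v\in V(G)$ is a Roman $(k,k)$-dominating family on $G$; the maximum number of functions in such a family is the Roman $(k,k)$-domatic number $d_R^k(G)$. -}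

module Defs where

open import Data.Nat using (ℕ; zero; suc; _+_; _*_; _≤_)
open import Data.Fin using (Fin; toℕ)
open import Data.Bool using (Bool; true; false; if_then_else_)
open import Data.List using (List; map; sum; length)
open import Data.Fin.Base using (zero; suc)
open import Data.Vec.Functional using () renaming (foldr to vfoldr)
open import Data.Product using (Σ; _×_; ∃; ∃-syntax; _,_)
open import Relation.Binary.PropositionalEquality using (_≡_)
open import Relation.Nullary using (¬_)

record Graph (n : ℕ) : Set where
  field
    adj    : Fin n → Fin n → Bool
    sym    : ∀ u v → adj u v ≡ adj v u
    irrefl : ∀ v → adj v v ≡ false
open Graph public

sumFin : (n : ℕ) → (Fin n → ℕ) → ℕ
sumFin zero    g = 0
sumFin (suc n) g = g zero + sumFin n (λ i → g (suc i))

Labelling : ℕ → Set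
Labelling n = Fin n → Fin 3

val : {n : ℕ} → Labelling n → Fin n → ℕ
val f v = toℕ (f v)

weight : {n : ℕ} → Labelling n → ℕ
weight {n} f = sumFin n (val f)

isTwo : Fin 3 → ℕ
isTwo zero = 0
isTwo (suc zero) = 0
isTwo (suc (suc zero)) = 1

twoNbrs : {n : ℕ} → Graph n → Labelling n → Fin n → ℕ
twoNbrs {n} G f v = sumFin n (λ u → if adj G v u then isTwo (f u) else 0)

IsRkDF : {n : ℕ} → Graph n → ℕ → Labelling n → Set
IsRkDF G k f = ∀ v → f v ≡ zero → k ≤ twoNbrs G f v

IsRomanKDomNumber : {n : ℕ} → Graph n → ℕ → ℕ → Set
IsRomanKDomNumber G k γ =
  (Σ (Labelling _) λ f → IsRkDF G k f × weight f ≡ γ) ×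
  (∀ f → IsRkDF G k f → γ ≤ weight f)

IsRkkFamily : {n : ℕ} → Graph n → ℕ → (d : ℕ) → (Fin d → Labelling n) → Set
IsRkkFamily {n} G k d F =
  (∀ i j → (∀ v → F i v ≡ F j v) → i ≡ j) ×
  (∀ i → IsRkDF G k (F i)) ×
  (∀ v → sumFin d (λ i → val (F i) v) ≤ 2 * k)

IsRomanKKDomatic : {n : ℕ} → Graph n → ℕ → ℕ → Set
IsRomanKKDomatic {n} G k d =
  (Σ (Fin d → Labelling n) λ F → IsRkkFamily G k d F) ×
  (∀ d' (F : Fin d' → Labelling n) → IsRkkFamily G k d' F → d' ≤ d)

-- Double counting: the total weight of a Roman (k,k)-dominating family of d
-- functions is at least d·γ, since each function weighs at least γ, and at most
-- 2k·n, since every vertex carries at most 2k of it. When γ·d = 2kn both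
-- inequalities are equalities, which forces each termwise bound to be tight.
module Submission where

open import Defs hiding (sym)
open import Data.Nat using (ℕ; _*_; _≤_; _+_; zero; suc)
open import Data.Nat.Properties
open import Algebra.Properties.CommutativeSemigroup +-commutativeSemigroup
  using (interchange)
open import Data.Fin using (Fin)
open import Data.Fin.Base using (zero; suc)
open import Data.Product using (_×_; _,_; proj₁; proj₂)
open import Relation.Binary.PropositionalEquality

sumFin-const : ∀ n a → sumFin n (λ _ → a) ≡ n * a
sumFin-const zero    a = refl
sumFin-const (suc n) a = cong (a +_) (sumFin-const n a)

sumFin-+ : ∀ n (f g : Fin n → ℕ) →
  sumFin n (λ v → f v + g v) ≡ sumFin n f + sumFin n g
sumFin-+ zero    f g = refl
sumFin-+ (suc n) f g = begin
  (f zero + g zero) + sumFin n (λ i → f (suc i) + g (suc i))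
    ≡⟨ cong ((f zero + g zero) +_) (sumFin-+ n (λ i → f (suc i)) (λ i → g (suc i))) ⟩
  (f zero + g zero) + (sumFin n (λ i → f (suc i)) + sumFin n (λ i → g (suc i)))
    ≡⟨ interchange (f zero) (g zero) _ _ ⟩
  sumFin (suc n) f + sumFin (suc n) g ∎
  where open ≡-Reasoning

sumFin-swap : ∀ n d (h : Fin d → Fin n → ℕ) →
  sumFin n (λ v → sumFin d (λ i → h i v)) ≡ sumFin d (λ i → sumFin n (h i))
sumFin-swap n zero    h = trans (sumFin-const n 0) (*-zeroʳ n)
sumFin-swap n (suc d) h = begin
  sumFin n (λ v → h zero v + sumFin d (λ i → h (suc i) v))
    ≡⟨ sumFin-+ n (h zero) (λ v → sumFin d (λ i → h (suc i) v)) ⟩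
  sumFin n (h zero) + sumFin n (λ v → sumFin d (λ i → h (suc i) v))
    ≡⟨ cong (sumFin n (h zero) +_) (sumFin-swap n d (λ i → h (suc i))) ⟩
  sumFin (suc d) (λ i → sumFin n (h i)) ∎
  where open ≡-Reasoning

sumFin-mono-≤ : ∀ n {f g : Fin n → ℕ} → (∀ i → f i ≤ g i) → sumFin n f ≤ sumFin n g
sumFin-mono-≤ zero    f≤g = ≤-refl
sumFin-mono-≤ (suc n) f≤g = +-mono-≤ (f≤g zero) (sumFin-mono-≤ n (λ i → f≤g (suc i)))

sumFin-mono-≤-tight : ∀ n {f g : Fin n → ℕ} → (∀ i → f i ≤ g i) →
  sumFin n g ≤ sumFin n f → ∀ i → f i ≡ g i
sumFin-mono-≤-tight (suc n) {f} {g} f≤g Σg≤Σf = tight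
  where
  Σf′ = sumFin n (λ i → f (suc i))
  Σg′ = sumFin n (λ i → g (suc i))

  Σf′≤Σg′ : Σf′ ≤ Σg′
  Σf′≤Σg′ = sumFin-mono-≤ n (λ i → f≤g (suc i))

  g₀≤f₀ : g zero ≤ f zero
  g₀≤f₀ = +-cancelʳ-≤ Σg′ (g zero) (f zero) (≤-trans Σg≤Σf (+-monoʳ-≤ (f zero) Σf′≤Σg′))

  Σg′≤Σf′ : Σg′ ≤ Σf′
  Σg′≤Σf′ = +-cancelˡ-≤ (g zero) Σg′ Σf′ (≤-trans Σg≤Σf (+-monoˡ-≤ Σf′ (f≤g zero)))

  tight : ∀ i → f i ≡ g i
  tight zero    = ≤-antisym (f≤g zero) g₀≤f₀
  tight (suc i) = sumFin-mono-≤-tight n (λ i → f≤g (suc i)) Σg′≤Σf′ i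

module RkkFamily {n d : ℕ} (G : Graph n) (k : ℕ)
                 (F : Fin d → Labelling n) (fam : IsRkkFamily G k d F) where

  isRkDF : ∀ i → IsRkDF G k (F i)
  isRkDF = proj₁ (proj₂ fam)

  columnSum : Fin n → ℕ
  columnSum v = sumFin d (λ i → val (F i) v)

  columnSum≤2k : ∀ v → columnSum v ≤ 2 * k
  columnSum≤2k = proj₂ (proj₂ fam)

  totalWeight : ℕ
  totalWeight = sumFin d (λ i → weight (F i))

  totalWeight≡sumColumns : totalWeight ≡ sumFin n columnSum
  totalWeight≡sumColumns = sym (sumFin-swap n d (λ i v → val (F i) v))

  totalWeight≤ : totalWeight ≤ n * (2 * k)
  totalWeight≤ = begin
    totalWeight              ≡⟨ totalWeight≡sumColumns ⟩
    sumFin n columnSum       ≤⟨ sumFin-mono-≤ n columnSum≤2k ⟩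
    sumFin n (λ _ → 2 * k)   ≡⟨ sumFin-const n (2 * k) ⟩
    n * (2 * k)              ∎
    where open ≤-Reasoning

  module _ {γ : ℕ} (hγ : IsRomanKDomNumber G k γ) where

    γ≤weight : ∀ i → γ ≤ weight (F i)
    γ≤weight i = proj₂ hγ (F i) (isRkDF i)

    ≤totalWeight : d * γ ≤ totalWeight
    ≤totalWeight = begin
      d * γ                  ≡⟨ sumFin-const d γ ⟨
      sumFin d (λ _ → γ)     ≤⟨ sumFin-mono-≤ d γ≤weight ⟩
      totalWeight            ∎
      where open ≤-Reasoning

    module _ (extremal : d * γ ≡ n * (2 * k)) where

      weight≡γ : ∀ i → weight (F i) ≡ γ
      weight≡γ i = sym (sumFin-mono-≤-tight d γ≤weight Σweight≤dγ i)
        where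
        Σweight≤dγ : totalWeight ≤ sumFin d (λ _ → γ)
        Σweight≤dγ = subst (totalWeight ≤_)
          (trans (sym extremal) (sym (sumFin-const d γ))) totalWeight≤

      columnSum≡2k : ∀ v → columnSum v ≡ 2 * k
      columnSum≡2k = sumFin-mono-≤-tight n columnSum≤2k Σ2k≤Σcolumns
        where
        Σ2k≤Σcolumns : sumFin n (λ _ → 2 * k) ≤ sumFin n columnSum
        Σ2k≤Σcolumns = subst₂ _≤_
          (trans extremal (sym (sumFin-const n (2 * k))))
          totalWeight≡sumColumns ≤totalWeight

theorem1 : (k n : ℕ) → 1 ≤ k → (G : Graph n) → (γ d : ℕ) →
    IsRomanKDomNumber G k γ → IsRomanKKDomatic G k d →
    (γ * d ≤ 2 * k * n) ×
    (γ * d ≡ 2 * k * n →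
      (F : Fin d → Labelling n) → IsRkkFamily G k d F →
      ((i : Fin d) → IsRkDF G k (F i) × weight (F i) ≡ γ) ×
      ((v : Fin n) → sumFin d (λ i → val (F i) v) ≡ 2 * k))
theorem1 k n _ G γ d hγ ((F₀ , fam₀) , _) = bound , equalityCase
  where
  bound : γ * d ≤ 2 * k * n
  bound = subst₂ _≤_ (*-comm d γ) (*-comm n (2 * k))
    (≤-trans (RkkFamily.≤totalWeight G k F₀ fam₀ hγ) (RkkFamily.totalWeight≤ G k F₀ fam₀))

  equalityCase : γ * d ≡ 2 * k * n → (F : Fin d → Labelling n) → IsRkkFamily G k d F →
    ((i : Fin d) → IsRkDF G k (F i) × weight (F i) ≡ γ) ×
    ((v : Fin n) → sumFin d (λ i → val (F i) v) ≡ 2 * k)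
  equalityCase γd≡2kn F fam =
    (λ i → isRkDF i , weight≡γ hγ extremal i) , columnSum≡2k hγ extremal
    where
    open RkkFamily G k F fam
    extremal : d * γ ≡ n * (2 * k)
    extremal = trans (*-comm d γ) (trans γd≡2kn (*-comm (2 * k) n))
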